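{- Let $G$ be a semisimple group of order $n$ and let $H$ be an arbitrary group of order $n$. If $H$ is not semisimple, then Spoiler can win in the $(4,2)$-WL$^2_{II}$ game on $G$ and $H$.
   Context: A finite group is semisimple if it has no nontrivial Abelian normal subgroups. For tuples $\overline{g}\in G^m,\overline{h}\in H^m$, $(\overline{g},\overline{h})$ gives a marked isomorphism if $g_i=g_j\Leftrightarrow h_i=h_j$ for all $i,j$ and $g_i\mapsto h_i$ extends to an isomorphism $\langle g_1,\dots,g_m\rangle\to\langle h_1,\dots,h_m\rangle$. The $(k,r)$-WL$^2_{II}$ game on $G,H$: Spoiler and Duplicator, $k$ pebble pairs $(p_i,p_i')$ initially off the board. Each round: (1) Spoiler picks up one or two pebble pairs; (2) the winning condition is checked; (3) Duplicator chooses a bijection $f\colon G\to H$; (4) Spoiler places each picked-up $p_i$ on some $v_i\in G$ and $p_i'$ is placed on $f(v_i)$. Spoiler wins if at some check during the first $r$ rounds (including the configuration after round $r$) the pebbled elements $\overline{v}$ of $G$ and corresponding $\overline{v}'$ of $H$ do not give a marked isomorphism. "Spoiler can win" means Spoiler has a winning strategy. -}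

module Defs where

open import Level using (0ℓ)
open import Data.Nat using (ℕ; zero; suc)
open import Data.Fin using (Fin)
open import Data.Fin.Properties using (_≟_)
open import Data.Maybe using (Maybe; just; nothing)
open import Data.Product using (Σ; ∃; _×_; _,_; proj₁; proj₂)
open import Data.Sum using (_⊎_)
open import Relation.Nullary using (¬_; yes; no)
open import Relation.Binary.PropositionalEquality using (_≡_; _≢_)
open import Algebra.Structures using (IsGroup)
open import Function.Bundles using (_⇔_; _⤖_; Bijection)

record FinGroup (n : ℕ) : Set where
  infixl 7 _∙_
  field
    _∙_     : Fin n → Fin n → Fin n
    ε       : Fin n
    _⁻¹     : Fin n → Fin n
    isGroup : IsGroup _≡_ _∙_ ε _⁻¹

module _ {n : ℕ} (G : FinGroup n) where
  open FinGroup G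

  IsNormalSubgroup : (Fin n → Set) → Set
  IsNormalSubgroup N =
    N ε ×
    (∀ x y → N x → N y → N (x ∙ y)) ×
    (∀ x → N x → N (x ⁻¹)) ×
    (∀ g x → N x → N ((g ∙ x) ∙ (g ⁻¹)))

  IsAbelianSub : (Fin n → Set) → Set
  IsAbelianSub N = ∀ x y → N x → N y → x ∙ y ≡ y ∙ x

  Semisimple : Set₁
  Semisimple = ∀ (N : Fin n → Set) → IsNormalSubgroup N → IsAbelianSub N →
               ∀ x → N x → x ≡ ε

  data Gen {I : Set} (g : I → Fin n) : Fin n → Set where
    gen  : ∀ i → Gen g (g i)
    unit : Gen g ε
    mul  : ∀ {x y} → Gen g x → Gen g y → Gen g (x ∙ y)
    inv  : ∀ {x} → Gen g x → Gen g (x ⁻¹)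

module _ {n : ℕ} (G H : FinGroup n) where
  private
    module G = FinGroup G
    module H = FinGroup H

  IsIsoOn : (Fin n → Set) → (Fin n → Set) → (Fin n → Fin n) → Set
  IsIsoOn A B φ =
    (∀ x → A x → B (φ x)) ×
    (∀ x y → A x → A y → φ (x G.∙ y) ≡ φ x H.∙ φ y) ×
    (∀ x y → A x → A y → φ x ≡ φ y → x ≡ y) ×
    (∀ y → B y → ∃ λ x → A x × φ x ≡ y)

  MarkedIso : {I : Set} → (I → Fin n) → (I → Fin n) → Set
  MarkedIso g h =
    (∀ i j → (g i ≡ g j) ⇔ (h i ≡ h j)) ×
    (∃ λ φ → IsIsoOn (Gen G g) (Gen H h) φ × (∀ i → φ (g i) ≡ h i))

  -- The (k,r)-WL²_II game.
  -- A configuration records, for each pebble pair i, either nothing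
  -- (off the board) or the pair (v , v') of pebbled elements of G and H.

  Config : ℕ → Set
  Config k = Fin k → Maybe (Fin n × Fin n)

  OnBoard : ∀ {k} → Config k → Set
  OnBoard {k} c = Σ (Fin k) λ i → Σ (Fin n × Fin n) λ p → c i ≡ just p

  Marked : ∀ {k} → Config k → Set
  Marked c = MarkedIso (λ (o : OnBoard c) → proj₁ (proj₁ (proj₂ o)))
                       (λ (o : OnBoard c) → proj₂ (proj₁ (proj₂ o)))

  data Pick (k : ℕ) : Set where
    one : Fin k → Pick k
    two : (i j : Fin k) → i ≢ j → Pick k

  set : ∀ {k} → Fin k → Maybe (Fin n × Fin n) → Config k → Config k
  set i m c j with j ≟ i
  ... | yes _ = m
  ... | no  _ = c j

  pickUp : ∀ {k} → Pick k → Config k → Config k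
  pickUp (one i)     c = set i nothing c
  pickUp (two i j _) c = set j nothing (set i nothing c)

  Placement : ∀ {k} → Pick k → Set
  Placement (one _)     = Fin n
  Placement (two _ _ _) = Fin n × Fin n

  place : ∀ {k} (p : Pick k) → Placement p → (Fin n → Fin n) → Config k → Config k
  place (one i)     v        f c = set i (just (v , f v)) c
  place (two i j _) (v , w)  f c = set j (just (w , f w)) (set i (just (v , f v)) c)

  -- Spoiler has a winning strategy when r rounds remain, from configuration c
  -- (checks happen after the pick-up step of each round, and after the last round)
  SpoilerWins : ∀ {k} → ℕ → Config k → Set
  SpoilerWins zero    c = ¬ Marked c
  SpoilerWins (suc r) c =
    Σ (Pick _) λ p →
      ¬ Marked (pickUp p c) ⊎
      (∀ (f : Fin n ⤖ Fin n) → Σ (Placement p) λ v →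
         SpoilerWins r (place p v (Bijection.to f) (pickUp p c)))

  SpoilerCanWin : ℕ → ℕ → Set
  SpoilerCanWin k r = SpoilerWins {k} r (λ _ → nothing)

module Submission where

open import Defs
open import Data.Nat using (ℕ)
open import Relation.Nullary using (¬_; Dec; yes; no; contradiction)

open import Level using (0ℓ)
open import Data.Fin using (Fin; zero; suc)
open import Data.Fin.Properties using (_≟_; all?; ¬∀⟶∃¬)
open import Data.Maybe using (nothing)
open import Data.Product using (∃; ∃₂; _×_; _,_; proj₁; proj₂)
open import Data.Sum using (inj₁; inj₂)
open import Relation.Nullary.Decidable using (decidable-stable; _→-dec_)
open import Relation.Binary.PropositionalEquality
open import Algebra.Bundles using (Group)
open import Algebra.Structures using (IsGroup)
import Algebra.Properties.Group as GroupProperties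
open import Function.Base using (_∘′_)
open import Function.Bundles using (_⤖_; Bijection)

-- Semisimplicity is witnessed element by element: the normal closure of v
-- is Abelian exactly when all conjugates of v commute pairwise, so G is
-- semisimple iff every v ≠ 1 has two non-commuting conjugates g v g⁻¹ and
-- h v h⁻¹.  Spoiler pebbles the preimage v of a nontrivial x ∈ H whose
-- conjugates commute; in the second round either v = 1 (already a mismatch)
-- or he pebbles such g and h, and a marked isomorphism would carry the
-- non-commuting pair onto a commuting pair in H.

module FinGroupProperties {n : ℕ} (G : FinGroup n) where
  open FinGroup G public
  open IsGroup isGroup public using (assoc; identityˡ; identityʳ; inverseˡ; inverseʳ)

  private
    group : Group 0ℓ 0ℓ
    group = record { isGroup = isGroup }

  open GroupProperties group public
    using (identityˡ-unique; inverseˡ-unique; ⁻¹-anti-homo-∙; ⁻¹-involutive; ε⁻¹≈ε)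
  open ≡-Reasoning

  IsSubgroup : (Fin n → Set) → Set
  IsSubgroup S = S ε × (∀ {x y} → S x → S y → S (x ∙ y)) × (∀ {x} → S x → S (x ⁻¹))

  Gen-isSubgroup : ∀ {I} (g : I → Fin n) → IsSubgroup (Gen G g)
  Gen-isSubgroup g = unit , mul , inv

  Gen-minimal : ∀ {I} {g : I → Fin n} {S : Fin n → Set} → IsSubgroup S →
                (∀ i → S (g i)) → ∀ {x} → Gen G g x → S x
  Gen-minimal S-sub gS (gen i)   = gS i
  Gen-minimal (Sε , _ , _) gS unit = Sε
  Gen-minimal S-sub@(_ , S∙ , _) gS (mul p q) = S∙ (Gen-minimal S-sub gS p) (Gen-minimal S-sub gS q)
  Gen-minimal S-sub@(_ , _ , S⁻¹) gS (inv p)  = S⁻¹ (Gen-minimal S-sub gS p)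

  conj : Fin n → Fin n → Fin n
  conj g v = (g ∙ v) ∙ (g ⁻¹)

  ε-conj : ∀ v → conj ε v ≡ v
  ε-conj v = trans (cong₂ _∙_ (identityˡ v) ε⁻¹≈ε) (identityʳ v)

  conj-conj : ∀ k g v → conj k (conj g v) ≡ conj (k ∙ g) v
  conj-conj k g v = begin
    (k ∙ ((g ∙ v) ∙ g ⁻¹)) ∙ k ⁻¹   ≡⟨ cong (_∙ k ⁻¹) (sym (assoc k (g ∙ v) (g ⁻¹))) ⟩
    ((k ∙ (g ∙ v)) ∙ g ⁻¹) ∙ k ⁻¹   ≡⟨ assoc _ _ _ ⟩
    (k ∙ (g ∙ v)) ∙ (g ⁻¹ ∙ k ⁻¹)   ≡⟨ cong₂ _∙_ (sym (assoc k g v)) (sym (⁻¹-anti-homo-∙ k g)) ⟩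
    ((k ∙ g) ∙ v) ∙ (k ∙ g) ⁻¹      ∎

  conj-ε : ∀ k → conj k ε ≡ ε
  conj-ε k = trans (cong (_∙ k ⁻¹) (identityʳ k)) (inverseʳ k)

  conj-∙ : ∀ k x y → conj k (x ∙ y) ≡ conj k x ∙ conj k y
  conj-∙ k x y = sym (begin
    ((k ∙ x) ∙ k ⁻¹) ∙ ((k ∙ y) ∙ k ⁻¹)   ≡⟨ sym (assoc _ _ _) ⟩
    (((k ∙ x) ∙ k ⁻¹) ∙ (k ∙ y)) ∙ k ⁻¹   ≡⟨ cong (_∙ k ⁻¹) (assoc _ _ _) ⟩
    ((k ∙ x) ∙ (k ⁻¹ ∙ (k ∙ y))) ∙ k ⁻¹   ≡⟨ cong (λ z → ((k ∙ x) ∙ z) ∙ k ⁻¹) (sym (assoc _ _ _)) ⟩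
    ((k ∙ x) ∙ ((k ⁻¹ ∙ k) ∙ y)) ∙ k ⁻¹   ≡⟨ cong (λ z → ((k ∙ x) ∙ (z ∙ y)) ∙ k ⁻¹) (inverseˡ k) ⟩
    ((k ∙ x) ∙ (ε ∙ y)) ∙ k ⁻¹            ≡⟨ cong (λ z → ((k ∙ x) ∙ z) ∙ k ⁻¹) (identityˡ y) ⟩
    ((k ∙ x) ∙ y) ∙ k ⁻¹                  ≡⟨ cong (_∙ k ⁻¹) (assoc k x y) ⟩
    (k ∙ (x ∙ y)) ∙ k ⁻¹                  ∎)

  conj-⁻¹ : ∀ k x → conj k (x ⁻¹) ≡ (conj k x) ⁻¹
  conj-⁻¹ k x = sym (begin
    ((k ∙ x) ∙ k ⁻¹) ⁻¹        ≡⟨ ⁻¹-anti-homo-∙ (k ∙ x) (k ⁻¹) ⟩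
    (k ⁻¹) ⁻¹ ∙ (k ∙ x) ⁻¹     ≡⟨ cong₂ _∙_ (⁻¹-involutive k) (⁻¹-anti-homo-∙ k x) ⟩
    k ∙ (x ⁻¹ ∙ k ⁻¹)          ≡⟨ sym (assoc _ _ _) ⟩
    (k ∙ x ⁻¹) ∙ k ⁻¹          ∎)

  Commute : Fin n → Fin n → Set
  Commute x y = x ∙ y ≡ y ∙ x

  commute? : ∀ x y → Dec (Commute x y)
  commute? x y = x ∙ y ≟ y ∙ x

  centraliser-isSubgroup : ∀ y → IsSubgroup (λ x → Commute x y)
  centraliser-isSubgroup y = commute-ε , commute-∙ , commute-⁻¹
    where
    commute-ε : Commute ε y
    commute-ε = trans (identityˡ y) (sym (identityʳ y))

    commute-∙ : ∀ {a b} → Commute a y → Commute b y → Commute (a ∙ b) y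
    commute-∙ {a} {b} ay by = begin
      (a ∙ b) ∙ y   ≡⟨ assoc a b y ⟩
      a ∙ (b ∙ y)   ≡⟨ cong (a ∙_) by ⟩
      a ∙ (y ∙ b)   ≡⟨ sym (assoc a y b) ⟩
      (a ∙ y) ∙ b   ≡⟨ cong (_∙ b) ay ⟩
      (y ∙ a) ∙ b   ≡⟨ assoc y a b ⟩
      y ∙ (a ∙ b)   ∎

    commute-⁻¹ : ∀ {a} → Commute a y → Commute (a ⁻¹) y
    commute-⁻¹ {a} ay = begin
      a ⁻¹ ∙ y                    ≡⟨ cong (a ⁻¹ ∙_) (sym (identityʳ y)) ⟩
      a ⁻¹ ∙ (y ∙ ε)              ≡⟨ cong (λ z → a ⁻¹ ∙ (y ∙ z)) (sym (inverseʳ a)) ⟩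
      a ⁻¹ ∙ (y ∙ (a ∙ a ⁻¹))     ≡⟨ cong (a ⁻¹ ∙_) (sym (assoc y a (a ⁻¹))) ⟩
      a ⁻¹ ∙ ((y ∙ a) ∙ a ⁻¹)     ≡⟨ cong (λ z → a ⁻¹ ∙ (z ∙ a ⁻¹)) (sym ay) ⟩
      a ⁻¹ ∙ ((a ∙ y) ∙ a ⁻¹)     ≡⟨ cong (a ⁻¹ ∙_) (assoc a y (a ⁻¹)) ⟩
      a ⁻¹ ∙ (a ∙ (y ∙ a ⁻¹))     ≡⟨ sym (assoc _ _ _) ⟩
      (a ⁻¹ ∙ a) ∙ (y ∙ a ⁻¹)     ≡⟨ cong (_∙ (y ∙ a ⁻¹)) (inverseˡ a) ⟩
      ε ∙ (y ∙ a ⁻¹)              ≡⟨ identityˡ _ ⟩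
      y ∙ a ⁻¹                    ∎

  Gen-abelian : ∀ {I} {g : I → Fin n} → (∀ i j → Commute (g i) (g j)) →
                IsAbelianSub G (Gen G g)
  Gen-abelian {g = g} gg x y p q = Gen-minimal (centraliser-isSubgroup y) commute-y p
    where
    commute-y : ∀ i → Commute (g i) y
    commute-y i = sym (Gen-minimal (centraliser-isSubgroup (g i)) (λ j → gg j i) q)

  ConjugatesCommute : Fin n → Set
  ConjugatesCommute v = ∀ g h → Commute (conj g v) (conj h v)

  conjugatesCommute? : ∀ v → Dec (ConjugatesCommute v)
  conjugatesCommute? v = all? λ g → all? λ h → commute? (conj g v) (conj h v)

  normalClosure-normal : ∀ v → IsNormalSubgroup G (Gen G (λ g → conj g v))
  normalClosure-normal v = unit , (λ _ _ → mul) , (λ _ → inv) ,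
                           (λ k _ → Gen-minimal conj-closed conj-gen)
    where
    N : Fin n → Set
    N = Gen G (λ g → conj g v)

    conj-closed : ∀ {k} → IsSubgroup (λ x → N (conj k x))
    conj-closed {k} = subst N (sym (conj-ε k)) unit
                    , (λ {x} {y} p q → subst N (sym (conj-∙ k x y)) (mul p q))
                    , (λ {x} p → subst N (sym (conj-⁻¹ k x)) (inv p))

    conj-gen : ∀ {k} g → N (conj k (conj g v))
    conj-gen {k} g = subst N (sym (conj-conj k g v)) (gen (k ∙ g))

  semisimple⇒conjugatesCommute⇒≡ε : Semisimple G → ∀ v → ConjugatesCommute v → v ≡ ε
  semisimple⇒conjugatesCommute⇒≡ε ss v cc =
    ss _ (normalClosure-normal v) (Gen-abelian cc) v (subst (Gen G _) (ε-conj v) (gen ε))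

  conjugatesCommute⇒≡ε⇒semisimple : (∀ v → ConjugatesCommute v → v ≡ ε) → Semisimple G
  conjugatesCommute⇒≡ε⇒semisimple triv N (_ , _ , _ , N-conj) N-abelian x Nx =
    triv x λ g h → N-abelian _ _ (N-conj g x Nx) (N-conj h x Nx)

  semisimple⇒nonCommutingConjugates : Semisimple G → ∀ {v} → v ≢ ε →
                                      ∃₂ λ g h → ¬ Commute (conj g v) (conj h v)
  semisimple⇒nonCommutingConjugates ss {v} v≢ε
    with g , ¬∀h ← ¬∀⟶∃¬ n _ (λ g → all? λ h → commute? (conj g v) (conj h v))
                   (v≢ε ∘′ semisimple⇒conjugatesCommute⇒≡ε ss v)
    with h , ¬commute ← ¬∀⟶∃¬ n _ (λ h → commute? (conj g v) (conj h v)) ¬∀h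
    = g , h , ¬commute

  ¬semisimple⇒commutingConjugates : ¬ Semisimple G → ∃ λ x → x ≢ ε × ConjugatesCommute x
  ¬semisimple⇒commutingConjugates ¬ss
    with x , ¬triv ← ¬∀⟶∃¬ n _ (λ v → conjugatesCommute? v →-dec v ≟ ε)
                       (¬ss ∘′ conjugatesCommute⇒≡ε⇒semisimple)
    = x , (λ x≡ε → ¬triv λ _ → x≡ε)
        , decidable-stable (conjugatesCommute? x) (λ ¬cc → ¬triv λ cc → contradiction cc ¬cc)

module PartialIsomorphism {n : ℕ} (G H : FinGroup n) {A B : Fin n → Set} {φ : Fin n → Fin n}
                          (A-sub : FinGroupProperties.IsSubgroup G A)
                          (iso : IsIsoOn G H A B φ) where
  private
    module G = FinGroupProperties G
    module H = FinGroupProperties H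
  open G using (_∙_; _⁻¹)

  private
    A-ε : A G.ε
    A-ε = proj₁ A-sub

    A-∙ : ∀ {x y} → A x → A y → A (x ∙ y)
    A-∙ = proj₁ (proj₂ A-sub)

    A-⁻¹ : ∀ {x} → A x → A (x ⁻¹)
    A-⁻¹ = proj₂ (proj₂ A-sub)

    φ-∙ : ∀ x y → A x → A y → φ (x ∙ y) ≡ φ x H.∙ φ y
    φ-∙ = proj₁ (proj₂ iso)

    φ-injective : ∀ x y → A x → A y → φ x ≡ φ y → x ≡ y
    φ-injective = proj₁ (proj₂ (proj₂ iso))

  φ-ε : φ G.ε ≡ H.ε
  φ-ε = H.identityˡ-unique _ _ (begin
    φ G.ε H.∙ φ G.ε   ≡⟨ sym (φ-∙ _ _ A-ε A-ε) ⟩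
    φ (G.ε ∙ G.ε)     ≡⟨ cong φ (G.identityˡ G.ε) ⟩
    φ G.ε             ∎)
    where open ≡-Reasoning

  φ-⁻¹ : ∀ {y} → A y → φ (y ⁻¹) ≡ φ y H.⁻¹
  φ-⁻¹ {y} Ay = H.inverseˡ-unique _ _
    (trans (sym (φ-∙ _ _ (A-⁻¹ Ay) Ay)) (trans (cong φ (G.inverseˡ y)) φ-ε))

  φ-conj : ∀ {g v} → A g → A v → φ (G.conj g v) ≡ H.conj (φ g) (φ v)
  φ-conj Ag Av = trans (φ-∙ _ _ (A-∙ Ag Av) (A-⁻¹ Ag)) (cong₂ H._∙_ (φ-∙ _ _ Ag Av) (φ-⁻¹ Ag))

  φ-reflects-commute : ∀ {a b} → A a → A b → H.Commute (φ a) (φ b) → G.Commute a b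
  φ-reflects-commute Aa Ab c =
    φ-injective _ _ (A-∙ Aa Ab) (A-∙ Ab Aa)
      (trans (φ-∙ _ _ Aa Ab) (trans c (sym (φ-∙ _ _ Ab Aa))))

module _ {n : ℕ} (G H : FinGroup n) {I : Set} {g h : I → Fin n} where
  private
    module G = FinGroupProperties G
    module H = FinGroupProperties H

  markedIso-ε : MarkedIso G H g h → ∀ i → g i ≡ G.ε → h i ≡ H.ε
  markedIso-ε (_ , φ , iso , φg≡h) i gi≡ε =
    trans (sym (φg≡h i)) (trans (cong φ gi≡ε) φ-ε)
    where open PartialIsomorphism G H (G.Gen-isSubgroup g) iso

  markedIso-reflects-commutingConjugates :
    MarkedIso G H g h → ∀ i j k →
    H.Commute (H.conj (h j) (h i)) (H.conj (h k) (h i)) →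
    G.Commute (G.conj (g j) (g i)) (G.conj (g k) (g i))
  markedIso-reflects-commutingConjugates (_ , φ , iso , φg≡h) i j k c =
    φ-reflects-commute (conj-in j) (conj-in k)
      (subst₂ H.Commute (sym (φ-conj-gen j)) (sym (φ-conj-gen k)) c)
    where
    open PartialIsomorphism G H (G.Gen-isSubgroup g) iso
    conj-in : ∀ j → Gen G g (G.conj (g j) (g i))
    conj-in j = mul (mul (gen j) (gen i)) (inv (gen j))
    φ-conj-gen : ∀ j → φ (G.conj (g j) (g i)) ≡ H.conj (h j) (h i)
    φ-conj-gen j = trans (φ-conj (gen j) (gen i)) (cong₂ H.conj (φg≡h j) (φg≡h i))

module _ {n : ℕ} (G H : FinGroup n) where
  private
    module G = FinGroupProperties G
    module H = FinGroupProperties H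

  spoilerWins-secondRound :
    Semisimple G → ∀ {x} → x ≢ H.ε → H.ConjugatesCommute x →
    (f : Fin n ⤖ Fin n) → ∀ {v} → Bijection.to f v ≡ x →
    SpoilerWins G H {4} 1 (place G H (one zero) v (Bijection.to f) (pickUp G H (one zero) (λ _ → nothing)))
  spoilerWins-secondRound ssG x≢ε x-cc f {v} refl with v ≟ G.ε
  ... | yes v≡ε = two (suc zero) (suc (suc zero)) (λ ()) , inj₁ λ marked →
        x≢ε (markedIso-ε G H marked (zero , _ , refl) v≡ε)
  ... | no v≢ε  = two (suc zero) (suc (suc zero)) (λ ()) , inj₂ λ _ →
        let g , h , ¬commute = G.semisimple⇒nonCommutingConjugates ssG v≢ε in
        (g , h) , λ marked → ¬commute
          (markedIso-reflects-commutingConjugates G H marked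
             (zero , _ , refl) (suc zero , _ , refl) (suc (suc zero) , _ , refl)
             (x-cc _ _))

proposition17 : (n : ℕ) (G H : FinGroup n) →
    Semisimple G → ¬ Semisimple H → SpoilerCanWin G H 4 2
proposition17 n G H ssG ¬ssH =
  let x , x≢ε , x-conjugatesCommute = FinGroupProperties.¬semisimple⇒commutingConjugates H ¬ssH in
  one zero , inj₂ λ f →
    let v , fv≡x = Bijection.surjective f x in
    v , spoilerWins-secondRound G H ssG x≢ε x-conjugatesCommute f (fv≡x refl)
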